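{- Let $m\ge2$ and let $B$ be a block of continued fraction digits with $q(B)\ge m$. Suppose $P/Q<P'/Q'$ are consecutive fractions in $\mathcal{F}_m$ with $\frac PQ<r_B<\frac{P'}{Q'}$. Let $B_1$ be the shortest block with $r_{B_1}=P/Q$, and let $B_2$ be the prefix of $B$ with $r_{B_2}=r_B(m)$. Then $-1\le|B_2|-|B_1|\le4$, and the prefixes of $B_1$ and $B_2$ of length $|B_1|-1$ coincide.
   Context: A block is a finite sequence $B=a_1\dots a_n$ of positive integers (the empty block $\wedge$ allowed), $|B|$ its length. $r_B=1/(a_1+1/(a_2+\dots+1/a_n))$, $r_\wedge=0/1$, and $q(B)$ is the denominator of $r_B$ in lowest terms. $r_B(m)=r_{B'}$ where $B'$ is the longest prefix of $B$ with $q(B')\le m$. $\mathcal{F}_m$ is the set of fractions in $[0,1]$ with denominator in lowest terms at most $m$; two elements are consecutive if no element of $\mathcal{F}_m$ lies strictly between them. -}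

module Defs where

open import Data.Nat as ℕ using (ℕ; zero; suc; _≤ᵇ_)
open import Data.Bool using (if_then_else_)
open import Data.List using (List; []; _∷_; take; length)
open import Data.List.Relation.Unary.All using (All)
open import Data.Rational as ℚ using (ℚ; 0ℚ; 1ℚ; _≟_; _+_; 1/_; ≢-nonZero)
open import Relation.Nullary using (yes; no)
open import Data.Integer as ℤ using ()
open import Data.Product using (_×_)
open import Data.Empty using (⊥)

Block : Set
Block = List ℕ

IsBlock : Block → Set
IsBlock B = All (ℕ._<_ 0) B

-- 1/x, with junk value 0 at x = 0 (never reached for genuine blocks,
-- since a + r ≥ 1 whenever a ≥ 1 and r ≥ 0).
inv : ℚ → ℚ
inv x with x ≟ 0ℚ
... | yes _ = 0ℚ
... | no x≢0 = (1/ x) {{≢-nonZero x≢0}}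

r : Block → ℚ
r []      = 0ℚ
r (a ∷ B) = inv ((ℤ.+ a ℚ./ 1) + r B)

-- q(B): denominator of r_B in lowest terms (ℚ is stored normalised)
q : Block → ℕ
q B = ℚ.denominatorℕ (r B)

search : ℕ → Block → ℕ → ℕ
search m B zero    = zero
search m B (suc k) = if q (take (suc k) B) ≤ᵇ m then suc k else search m B k

rAt : ℕ → Block → ℚ
rAt m B = r (take (search m B (length B)) B)

InFarey : ℕ → ℚ → Set
InFarey m x = (0ℚ ℚ.≤ x) × (x ℚ.≤ 1ℚ) × (ℚ.denominatorℕ x ℕ.≤ m)

Consecutive : ℕ → ℚ → ℚ → Set
Consecutive m x y = InFarey m x × InFarey m y × (∀ z → InFarey m z → x ℚ.< z → z ℚ.< y → ⊥)

-- Write B = X ++ a ∷ Y with X the longest prefix of denominator at most m, so that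
-- B₂ = X.  Let p/q = r X and let p′/q′ be the value of X at tail ∞.  The value of
-- X ++ T moves monotonically from p/q towards p′/q′ as r T grows, in a direction given
-- by the parity of the length of X.  Hence the neighbours of r B in 𝓕_m are p/q and the
-- intermediate fraction (p′ + j p)/(q′ + j q) with j maximal such that q′ + j q ≤ m:
-- the two are adjacent, their denominators sum to more than m, and r B lies between
-- them since j < a.  The intermediate fraction is r V for a block V that differs from
-- X only in its last digit, so the lower neighbour P/Q is the value of a block C with
-- Near C X.  Finally two blocks of equal value coincide up to splitting a last digit
-- a into a − 1, 1, which relates the shortest B₁ to C.
module Submission where

open import Defs
open import Data.Nat using (ℕ; _≤_; _+_; _∸_)
open import Data.List using (List; take; length)
open import Data.Rational as ℚ using (ℚ; _<_)
open import Data.Product using (_×_; ∃-syntax)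
open import Relation.Binary.PropositionalEquality using (_≡_)

open import Data.Nat as ℕ using (zero; suc; _*_; z≤n; s≤s; _≤ᵇ_)
open import Data.Nat.Properties
open import Data.Nat.DivMod using (_/_; _%_; m≡m%n+[m/n]*n; m%n<n; m/n*n≤m)
open import Data.Nat.Divisibility using (_∣_; ∣1⇒≡1; ∣m⇒∣m*n; ∣n⇒∣m*n; ∣m+n∣m⇒∣n)
open import Data.Nat.Coprimality as Coprimality using (Coprime)
open import Data.Nat.Tactic.RingSolver using (solve-∀)
open import Data.Integer as ℤ using ()
import Data.Integer.Properties as ℤ
open import Data.Rational using (mkℚ; 0ℚ; ↥_; ↧ₙ_)
import Data.Rational.Properties as ℚ
open import Data.List using ([]; _∷_; _++_; _∷ʳ_; drop; initLast; _∷ʳ′_)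
open import Data.List.Properties using (length-++; take-take; take++drop≡id; take-all; ++-identityʳ)
open import Data.List.Relation.Unary.All using ([]; _∷_)
import Data.List.Relation.Unary.All.Properties as All
open import Data.Product using (_,_; proj₁; proj₂; ∃₂)
open import Data.Sum using (_⊎_; inj₁; inj₂)
open import Data.Bool using (true; false; T)
open import Data.Unit using (tt)
open import Data.Empty using (⊥; ⊥-elim)
open import Relation.Nullary using (¬_; yes; no)
open import Relation.Binary.Definitions using (tri<; tri≈; tri>)
open import Relation.Binary.PropositionalEquality using (refl; sym; trans; cong; cong₂; subst; subst₂; module ≡-Reasoning)

take-++ˡ : ∀ {A : Set} {i} (xs ys : List A) → i ≤ length xs → take i (xs ++ ys) ≡ take i xs
take-++ˡ {i = zero} xs ys _ = refl
take-++ˡ {i = suc i} (x ∷ xs) ys (s≤s i≤) = cong (x ∷_) (take-++ˡ xs ys i≤)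

take-shorten : ∀ {A : Set} {i n} (xs ys : List A) → i ≤ n → take n xs ≡ take n ys → take i xs ≡ take i ys
take-shorten {i = i} {n} xs ys i≤n e = begin
  take i xs           ≡⟨ cong (λ k → take k xs) (sym i⊓n≡i) ⟩
  take (i ℕ.⊓ n) xs   ≡⟨ sym (take-take i n xs) ⟩
  take i (take n xs)  ≡⟨ cong (take i) e ⟩
  take i (take n ys)  ≡⟨ take-take i n ys ⟩
  take (i ℕ.⊓ n) ys   ≡⟨ cong (λ k → take k ys) i⊓n≡i ⟩
  take i ys           ∎
  where
  open ≡-Reasoning
  i⊓n≡i = m≤n⇒m⊓n≡m i≤n

take-∷-cong : ∀ {A : Set} n (a : A) xs ys → take (n ∸ 1) xs ≡ take (n ∸ 1) ys → take n (a ∷ xs) ≡ take n (a ∷ ys)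
take-∷-cong zero a xs ys _ = refl
take-∷-cong (suc n) a xs ys e = cong (a ∷_) e

split-at : ∀ {A : Set} k (xs : List A) → k ℕ.< length xs →
           ∃₂ λ a ys → xs ≡ take k xs ++ a ∷ ys × take (suc k) xs ≡ take k xs ∷ʳ a
split-at zero (x ∷ xs) _ = x , xs , refl , refl
split-at (suc k) (x ∷ xs) (s≤s k<) with split-at k xs k<
... | a , ys , xs≡ , take≡ = a , ys , cong (x ∷_) xs≡ , cong (x ∷_) take≡

length-∷ʳ : ∀ {A : Set} (xs : List A) a → length (xs ∷ʳ a) ≡ length xs + 1
length-∷ʳ xs a = length-++ xs

length≤length-∷ʳ+1 : ∀ {A : Set} (xs : List A) a → length xs ≤ length (xs ∷ʳ a) + 1
length≤length-∷ʳ+1 xs a = ≤-trans (m≤m+n _ 1) (≤-trans (≤-reflexive (sym (length-∷ʳ xs a))) (m≤m+n _ 1))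

-- Continuants

num den num∞ den∞ : Block → ℕ
num []      = 0
num (a ∷ X) = den X
den []      = 1
den (a ∷ X) = a * den X + num X
num∞ []      = 1
num∞ (a ∷ X) = den∞ X
den∞ []      = 0
den∞ (a ∷ X) = a * den∞ X + num∞ X

-- numAt X u v / denAt X u v is the value of X followed by a tail of value v / u;
-- num, den correspond to the tail 0 and num∞, den∞ to the tail ∞.
numAt denAt : Block → ℕ → ℕ → ℕ
numAt X u v = num X * u + num∞ X * v
denAt X u v = den X * u + den∞ X * v

prepend-digit : ∀ a d d∞ n n∞ s t →
  a * (d * s + d∞ * t) + (n * s + n∞ * t) ≡ (a * d + n) * s + (a * d∞ + n∞) * t
prepend-digit = solve-∀

num-++ : ∀ X Y → num (X ++ Y) ≡ numAt X (den Y) (num Y)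
den-++ : ∀ X Y → den (X ++ Y) ≡ denAt X (den Y) (num Y)
num∞-++ : ∀ X Y → num∞ (X ++ Y) ≡ numAt X (den∞ Y) (num∞ Y)
den∞-++ : ∀ X Y → den∞ (X ++ Y) ≡ denAt X (den∞ Y) (num∞ Y)
num-++ [] Y = sym (+-identityʳ (num Y))
num-++ (a ∷ X) Y = den-++ X Y
den-++ [] Y = sym (trans (+-identityʳ _) (+-identityʳ (den Y)))
den-++ (a ∷ X) Y =
  trans (cong₂ (λ d n → a * d + n) (den-++ X Y) (num-++ X Y))
        (prepend-digit a (den X) (den∞ X) (num X) (num∞ X) (den Y) (num Y))
num∞-++ [] Y = sym (+-identityʳ (num∞ Y))
num∞-++ (a ∷ X) Y = den∞-++ X Y
den∞-++ [] Y = sym (trans (+-identityʳ _) (+-identityʳ (den∞ Y)))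
den∞-++ (a ∷ X) Y =
  trans (cong₂ (λ d n → a * d + n) (den∞-++ X Y) (num∞-++ X Y))
        (prepend-digit a (den X) (den∞ X) (num X) (num∞ X) (den∞ Y) (num∞ Y))

num-∷ʳ : ∀ X a → num (X ∷ʳ a) ≡ numAt X a 1
num-∷ʳ X a = trans (num-++ X (a ∷ [])) (cong (λ t → num X * t + num∞ X * 1) (trans (+-identityʳ _) (*-identityʳ a)))

den-∷ʳ : ∀ X a → den (X ∷ʳ a) ≡ denAt X a 1
den-∷ʳ X a = trans (den-++ X (a ∷ [])) (cong (λ t → den X * t + den∞ X * 1) (trans (+-identityʳ _) (*-identityʳ a)))

last-digit-at-∞ : ∀ n n∞ a → n * (a * 0 + 1) + n∞ * 0 ≡ n
last-digit-at-∞ = solve-∀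

num∞-∷ʳ : ∀ X a → num∞ (X ∷ʳ a) ≡ num X
num∞-∷ʳ X a = trans (num∞-++ X (a ∷ [])) (last-digit-at-∞ (num X) (num∞ X) a)

den∞-∷ʳ : ∀ X a → den∞ (X ∷ʳ a) ≡ den X
den∞-∷ʳ X a = trans (den∞-++ X (a ∷ [])) (last-digit-at-∞ (den X) (den∞ X) a)

-- a / b < c / d with determinant 1
Adjacent : ℕ → ℕ → ℕ → ℕ → Set
Adjacent a b c d = c * b ≡ a * d + 1

Unimodular : Block → Set
Unimodular X = Adjacent (num X) (den X) (num∞ X) (den∞ X) ⊎ Adjacent (num∞ X) (den∞ X) (num X) (den X)

adjacent-prepend : ∀ a d d∞ n n∞ → Adjacent n d n∞ d∞ → Adjacent d∞ (a * d∞ + n∞) d (a * d + n)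
adjacent-prepend a d d∞ n n∞ h = begin
  d * (a * d∞ + n∞)         ≡⟨ expand a d d∞ n∞ ⟩
  a * d * d∞ + n∞ * d       ≡⟨ cong (a * d * d∞ +_) h ⟩
  a * d * d∞ + (n * d∞ + 1) ≡⟨ collect a d d∞ n ⟩
  d∞ * (a * d + n) + 1      ∎
  where
  open ≡-Reasoning
  expand : ∀ a d d∞ n∞ → d * (a * d∞ + n∞) ≡ a * d * d∞ + n∞ * d
  expand = solve-∀
  collect : ∀ a d d∞ n → a * d * d∞ + (n * d∞ + 1) ≡ d∞ * (a * d + n) + 1
  collect = solve-∀

unimodular : ∀ X → Unimodular X
unimodular [] = inj₁ refl
unimodular (a ∷ X) with unimodular X
... | inj₁ h = inj₂ (adjacent-prepend a (den X) (den∞ X) (num X) (num∞ X) h)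
... | inj₂ h = inj₁ (adjacent-prepend a (den∞ X) (den X) (num∞ X) (num X) h)

adjacent⇒coprimeˡ : ∀ a b c d → Adjacent a b c d → Coprime a b
adjacent⇒coprimeˡ a b c d h {k} (k∣a , k∣b) =
  ∣1⇒≡1 (∣m+n∣m⇒∣n (subst (k ∣_) h (∣n⇒∣m*n c k∣b)) (∣m⇒∣m*n d k∣a))

adjacent⇒coprimeʳ : ∀ a b c d → Adjacent a b c d → Coprime c d
adjacent⇒coprimeʳ a b c d h {k} (k∣c , k∣d) =
  ∣1⇒≡1 (∣m+n∣m⇒∣n (subst (k ∣_) h (∣m⇒∣m*n b k∣c)) (∣n⇒∣m*n a k∣d))

num-den-coprime : ∀ X → Coprime (num X) (den X)
num-den-coprime X with unimodular X
... | inj₁ h = adjacent⇒coprimeˡ _ _ (num∞ X) (den∞ X) h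
... | inj₂ h = adjacent⇒coprimeʳ (num∞ X) (den∞ X) _ _ h

den-pos : ∀ {X} → IsBlock X → 0 ℕ.< den X
den-pos [] = s≤s z≤n
den-pos {suc a ∷ X} (_ ∷ bX) = ≤-trans (den-pos bX) (≤-trans (m≤m+n (den X) (a * den X)) (m≤m+n _ (num X)))

num≤den : ∀ {X} → IsBlock X → num X ≤ den X
num≤den [] = z≤n
num≤den {suc a ∷ X} (_ ∷ bX) = ≤-trans (m≤m+n (den X) (a * den X)) (m≤m+n _ (num X))

den∞≤den : ∀ {X} → IsBlock X → den∞ X ≤ den X
den∞≤den bX = proj₁ (bounds bX)
  where
  shuffle : ∀ a d n → (d + a * d) + n ≡ (n + d) + a * d
  shuffle = solve-∀
  bounds : ∀ {X} → IsBlock X → den∞ X ≤ den X × num∞ X + den∞ X ≤ num X + den X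
  bounds [] = z≤n , ≤-refl
  bounds {suc a ∷ X} (_ ∷ bX) = step , +-mono-≤ (proj₁ (bounds bX)) step
    where
    step : (den∞ X + a * den∞ X) + num∞ X ≤ (den X + a * den X) + num X
    step = begin
      (den∞ X + a * den∞ X) + num∞ X ≡⟨ shuffle a (den∞ X) (num∞ X) ⟩
      (num∞ X + den∞ X) + a * den∞ X ≤⟨ +-mono-≤ (proj₂ (bounds bX)) (*-monoʳ-≤ a (proj₁ (bounds bX))) ⟩
      (num X + den X) + a * den X    ≡⟨ sym (shuffle a (den X) (num X)) ⟩
      (den X + a * den X) + num X    ∎
      where open ≤-Reasoning

NumDen : ℚ → ℕ → ℕ → Set
NumDen z n d = (↥ z ≡ ℤ.+ n) × (↧ₙ z ≡ d)

inv-positive : ∀ k d .(c : Coprime (suc k) (suc d)) (c′ : Coprime (suc d) (suc k)) →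
               inv (mkℚ (ℤ.+ suc k) d c) ≡ mkℚ (ℤ.+ suc d) k c′
inv-positive k d c c′ with mkℚ (ℤ.+ suc k) d c ℚ.≟ 0ℚ
... | yes p with () ← cong ↥_ p
... | no _ = refl

integer-plus : ∀ a n d .(c : Coprime n (suc d)) (c′ : Coprime (suc a * suc d + n) (suc d)) →
               (ℤ.+ suc a ℚ./ 1) ℚ.+ mkℚ (ℤ.+ n) d c ≡ mkℚ (ℤ.+ (suc a * suc d + n)) d c′
integer-plus a n d c c′ = begin
  (ℤ.+ suc a ℚ./ 1) ℚ.+ mkℚ (ℤ.+ n) d c
    ≡⟨ cong (ℚ._+ mkℚ (ℤ.+ n) d c) (ℚ.normalize-coprime (Coprimality.sym (Coprimality.1-coprimeTo (suc a)))) ⟩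
  (ℤ.+ suc a ℤ.* ℤ.+ suc d ℤ.+ ℤ.+ n ℤ.* ℤ.+ 1) ℚ./ (1 * suc d)
    ≡⟨ cong (ℚ._/ (1 * suc d)) numerator ⟩
  ℚ.normalize K (1 * suc d)
    ≡⟨ ℚ.normalize-cong {K} {1 * suc d} refl (*-identityˡ (suc d)) ⟩
  ℚ.normalize K (suc d)
    ≡⟨ ℚ.normalize-coprime c′ ⟩
  mkℚ (ℤ.+ K) d c′ ∎
  where
  open ≡-Reasoning
  K = suc a * suc d + n
  numerator : ℤ.+ suc a ℤ.* ℤ.+ suc d ℤ.+ ℤ.+ n ℤ.* ℤ.+ 1 ≡ ℤ.+ K
  numerator = trans (cong₂ ℤ._+_ (sym (ℤ.pos-* (suc a) (suc d))) (sym (ℤ.pos-* n 1)))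
                    (trans (sym (ℤ.pos-+ (suc a * suc d) (n * 1))) (cong (λ t → ℤ.+ (suc a * suc d + t)) (*-identityʳ n)))

numDen-prepend : ∀ a {z n d} → Coprime d (suc a * d + n) → NumDen z n d →
                 NumDen (inv ((ℤ.+ suc a ℚ./ 1) ℚ.+ z)) d (suc a * d + n)
numDen-prepend a {mkℚ _ d c} {n} c′ (refl , refl)
  rewrite integer-plus a n d c (Coprimality.sym c′)
        | inv-positive (d + a * suc d + n) d (Coprimality.sym c′) c′ = refl , refl

r-numDen : ∀ {X} → IsBlock X → NumDen (r X) (num X) (den X)
r-numDen [] = refl , refl
r-numDen {suc a ∷ X} (_ ∷ bX) = numDen-prepend a (num-den-coprime (suc a ∷ X)) (r-numDen bX)

q≡den : ∀ {X} → IsBlock X → q X ≡ den X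
q≡den bX = proj₂ (r-numDen bX)

numDen-unique : ∀ {z w n d n′ d′} → z ≡ w → NumDen z n d → NumDen w n′ d′ → n ≡ n′ × d ≡ d′
numDen-unique refl (n≡ , d≡) (n′≡ , d′≡) = ℤ.+-injective (trans (sym n≡) n′≡) , trans (sym d≡) d′≡

cross<⇒< : ∀ {z w n d n′ d′} → NumDen z n d → NumDen w n′ d′ → n * d′ ℕ.< n′ * d → z < w
cross<⇒< {mkℚ _ _ _} {mkℚ _ _ _} {n} {d} {n′} {d′} (refl , refl) (refl , refl) h =
  ℚ.*<* (subst₂ ℤ._<_ (ℤ.pos-* n d′) (ℤ.pos-* n′ d) (ℤ.+<+ h))

<⇒cross< : ∀ {z w n d n′ d′} → NumDen z n d → NumDen w n′ d′ → z < w → n * d′ ℕ.< n′ * d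
<⇒cross< {mkℚ _ _ _} {mkℚ _ _ _} {n} {d} {n′} {d′} (refl , refl) (refl , refl) (ℚ.*<* h) =
  ℤ.drop‿+<+ (subst₂ ℤ._<_ (sym (ℤ.pos-* n d′)) (sym (ℤ.pos-* n′ d)) h)

cross≤⇒≤ : ∀ {z w n d n′ d′} → NumDen z n d → NumDen w n′ d′ → n * d′ ≤ n′ * d → z ℚ.≤ w
cross≤⇒≤ {mkℚ _ _ _} {mkℚ _ _ _} {n} {d} {n′} {d′} (refl , refl) (refl , refl) h =
  ℚ.*≤* (subst₂ ℤ._≤_ (ℤ.pos-* n d′) (ℤ.pos-* n′ d) (ℤ.+≤+ h))

≤⇒cross≤ : ∀ {z w n d n′ d′} → NumDen z n d → NumDen w n′ d′ → z ℚ.≤ w → n * d′ ≤ n′ * d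
≤⇒cross≤ {mkℚ _ _ _} {mkℚ _ _ _} {n} {d} {n′} {d′} (refl , refl) (refl , refl) (ℚ.*≤* h) =
  ℤ.drop‿+≤+ (subst₂ ℤ._≤_ (sym (ℤ.pos-* n d′)) (sym (ℤ.pos-* n′ d)) h)

cross≡⇒≡ : ∀ {z w n d n′ d′} → NumDen z n d → NumDen w n′ d′ → n * d′ ≡ n′ * d → z ≡ w
cross≡⇒≡ {mkℚ _ _ _} {mkℚ _ _ _} {n} {d} {n′} {d′} (refl , refl) (refl , refl) h =
  ℚ.≃⇒≡ (ℚ.*≡* (trans (sym (ℤ.pos-* n d′)) (trans (cong ℤ.+_ h) (ℤ.pos-* n′ d))))

numDen-nonneg : ∀ x → 0ℚ ℚ.≤ x → NumDen x (ℤ.∣ ↥ x ∣) (↧ₙ x)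
numDen-nonneg (mkℚ (ℤ.+ n) _ _) _ = refl , refl
numDen-nonneg (mkℚ ℤ.-[1+ _ ] _ _) (ℚ.*≤* ())

r-InFarey : ∀ {m X} → IsBlock X → q X ≤ m → InFarey m (r X)
r-InFarey {m} {X} bX q≤m =
  cross≤⇒≤ (refl , refl) (r-numDen bX) z≤n ,
  cross≤⇒≤ (r-numDen bX) (refl , refl)
    (subst₂ _≤_ (sym (*-identityʳ (num X))) (sym (+-identityʳ (den X))) (num≤den bX)) ,
  q≤m

value-at-0 : ∀ {X} → IsBlock X → NumDen (r X) (numAt X 1 0) (denAt X 1 0)
value-at-0 {X} bX = subst₂ (NumDen (r X)) (sym (at-0 (num X) (num∞ X))) (sym (at-0 (den X) (den∞ X))) (r-numDen bX)
  where
  at-0 : ∀ n n∞ → n * 1 + n∞ * 0 ≡ n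
  at-0 = solve-∀

-- Farey neighbours

weighted-cross⁺ : ∀ P Q P′ Q′ u v u′ v′ → Adjacent P Q P′ Q′ →
  (P * u + P′ * v) * (Q * u′ + Q′ * v′) + v′ * u ≡ (P * u′ + P′ * v′) * (Q * u + Q′ * v) + v * u′
weighted-cross⁺ P Q P′ Q′ u v u′ v′ h = begin
  (P * u + P′ * v) * (Q * u′ + Q′ * v′) + v′ * u ≡⟨ expand P Q P′ Q′ u v u′ v′ ⟩
  K + P′ * Q * (v * u′)                          ≡⟨ cong (λ t → K + t * (v * u′)) h ⟩
  K + (P * Q′ + 1) * (v * u′)                    ≡⟨ swap P Q P′ Q′ u v u′ v′ ⟩
  K′ + (P * Q′ + 1) * (v′ * u)                   ≡⟨ cong (λ t → K′ + t * (v′ * u)) (sym h) ⟩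
  K′ + P′ * Q * (v′ * u)                         ≡⟨ collect P Q P′ Q′ u v u′ v′ ⟩
  (P * u′ + P′ * v′) * (Q * u + Q′ * v) + v * u′ ∎
  where
  open ≡-Reasoning
  K = P * Q * u * u′ + P * Q′ * u * v′ + P′ * Q′ * v * v′ + v′ * u
  K′ = P * Q * u * u′ + P * Q′ * u′ * v + P′ * Q′ * v * v′ + v * u′
  expand : ∀ P Q P′ Q′ u v u′ v′ → (P * u + P′ * v) * (Q * u′ + Q′ * v′) + v′ * u ≡
    (P * Q * u * u′ + P * Q′ * u * v′ + P′ * Q′ * v * v′ + v′ * u) + P′ * Q * (v * u′)
  expand = solve-∀
  swap : ∀ P Q P′ Q′ u v u′ v′ →
    (P * Q * u * u′ + P * Q′ * u * v′ + P′ * Q′ * v * v′ + v′ * u) + (P * Q′ + 1) * (v * u′) ≡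
    (P * Q * u * u′ + P * Q′ * u′ * v + P′ * Q′ * v * v′ + v * u′) + (P * Q′ + 1) * (v′ * u)
  swap = solve-∀
  collect : ∀ P Q P′ Q′ u v u′ v′ →
    (P * Q * u * u′ + P * Q′ * u′ * v + P′ * Q′ * v * v′ + v * u′) + P′ * Q * (v′ * u) ≡
    (P * u′ + P′ * v′) * (Q * u + Q′ * v) + v * u′
  collect = solve-∀

weighted-cross⁻ : ∀ P Q P′ Q′ u v u′ v′ → Adjacent P′ Q′ P Q →
  (P * u + P′ * v) * (Q * u′ + Q′ * v′) + v * u′ ≡ (P * u′ + P′ * v′) * (Q * u + Q′ * v) + v′ * u
weighted-cross⁻ P Q P′ Q′ u v u′ v′ h = begin
  (P * u + P′ * v) * (Q * u′ + Q′ * v′) + v * u′ ≡⟨ expand P Q P′ Q′ u v u′ v′ ⟩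
  K + P * Q′ * (u * v′)                          ≡⟨ cong (λ t → K + t * (u * v′)) h ⟩
  K + (P′ * Q + 1) * (u * v′)                    ≡⟨ swap P Q P′ Q′ u v u′ v′ ⟩
  K′ + (P′ * Q + 1) * (u′ * v)                   ≡⟨ cong (λ t → K′ + t * (u′ * v)) (sym h) ⟩
  K′ + P * Q′ * (u′ * v)                         ≡⟨ collect P Q P′ Q′ u v u′ v′ ⟩
  (P * u′ + P′ * v′) * (Q * u + Q′ * v) + v′ * u ∎
  where
  open ≡-Reasoning
  K = P * Q * u * u′ + P′ * Q * v * u′ + P′ * Q′ * v * v′ + v * u′
  K′ = P * Q * u * u′ + P′ * Q * v′ * u + P′ * Q′ * v * v′ + v′ * u
  expand : ∀ P Q P′ Q′ u v u′ v′ → (P * u + P′ * v) * (Q * u′ + Q′ * v′) + v * u′ ≡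
    (P * Q * u * u′ + P′ * Q * v * u′ + P′ * Q′ * v * v′ + v * u′) + P * Q′ * (u * v′)
  expand = solve-∀
  swap : ∀ P Q P′ Q′ u v u′ v′ →
    (P * Q * u * u′ + P′ * Q * v * u′ + P′ * Q′ * v * v′ + v * u′) + (P′ * Q + 1) * (u * v′) ≡
    (P * Q * u * u′ + P′ * Q * v′ * u + P′ * Q′ * v * v′ + v′ * u) + (P′ * Q + 1) * (u′ * v)
  swap = solve-∀
  collect : ∀ P Q P′ Q′ u v u′ v′ →
    (P * Q * u * u′ + P′ * Q * v′ * u + P′ * Q′ * v * v′ + v′ * u) + P * Q′ * (u′ * v) ≡
    (P * u′ + P′ * v′) * (Q * u + Q′ * v) + v′ * u
  collect = solve-∀

<-by-excess : ∀ {a b c d} → a + c ≡ b + d → d ℕ.< c → a ℕ.< b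
<-by-excess {a} {b} {c} {d} e d<c = +-cancelʳ-< c a b (subst (ℕ._< b + c) (sym e) (+-monoʳ-< b d<c))

≡+1-by-excess : ∀ {a b d} → a + (d + 1) ≡ b + d → b ≡ a + 1
≡+1-by-excess {a} {b} {d} e = +-cancelʳ-≡ d b (a + 1) (trans (sym e) (shuffle a d))
  where
  shuffle : ∀ a d → a + (d + 1) ≡ (a + 1) + d
  shuffle = solve-∀

module _ (X : Block) (u v u′ v′ : ℕ) where

  at-tail-adjacent⁺ : Adjacent (num X) (den X) (num∞ X) (den∞ X) → Adjacent v u v′ u′ →
                       Adjacent (numAt X u v) (denAt X u v) (numAt X u′ v′) (denAt X u′ v′)
  at-tail-adjacent⁺ h h′ =
    ≡+1-by-excess (trans (cong (numAt X u v * denAt X u′ v′ +_) (sym h′))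
                         (weighted-cross⁺ (num X) (den X) (num∞ X) (den∞ X) u v u′ v′ h))

  at-tail-adjacent⁻ : Adjacent (num∞ X) (den∞ X) (num X) (den X) → Adjacent v u v′ u′ →
                       Adjacent (numAt X u′ v′) (denAt X u′ v′) (numAt X u v) (denAt X u v)
  at-tail-adjacent⁻ h h′ =
    ≡+1-by-excess (sym (trans (weighted-cross⁻ (num X) (den X) (num∞ X) (den∞ X) u v u′ v′ h)
                              (cong (numAt X u′ v′ * denAt X u v +_) h′)))

  module _ {z w : ℚ} (z≐ : NumDen z (numAt X u v) (denAt X u v))
                     (w≐ : NumDen w (numAt X u′ v′) (denAt X u′ v′)) where

    at-tail-increasing : Adjacent (num X) (den X) (num∞ X) (den∞ X) → v * u′ ℕ.< v′ * u → z < w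
    at-tail-increasing h lt =
      cross<⇒< z≐ w≐ (<-by-excess (weighted-cross⁺ (num X) (den X) (num∞ X) (den∞ X) u v u′ v′ h) lt)

    at-tail-decreasing : Adjacent (num∞ X) (den∞ X) (num X) (den X) → v * u′ ℕ.< v′ * u → w < z
    at-tail-decreasing h lt =
      cross<⇒< w≐ z≐ (<-by-excess (sym (weighted-cross⁻ (num X) (den X) (num∞ X) (den∞ X) u v u′ v′ h)) lt)

-- A fraction strictly between adjacent a / b < c / d has denominator at least b + d.
farey-gap : ∀ a b c d e f {m} → Adjacent a b c d → m ℕ.< b + d → f ≤ m →
            a * f ≤ e * b → e * d ℕ.< c * f → a * f ≡ e * b
farey-gap a b c d e f {m} adj m<b+d f≤m af≤eb ed<cf with m≤n⇒m<n∨m≡n af≤eb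
... | inj₂ af≡eb = af≡eb
... | inj₁ af<eb = ⊥-elim (<⇒≱ m<b+d (≤-trans (+-cancelˡ-≤ S _ _ bound) f≤m))
  where
  open ≤-Reasoning
  S = a * d * f + b * d * e
  expand : ∀ a b d e f → a * d * f + b * d * e + (b + d) ≡ d * (a * f + 1) + b * (e * d + 1)
  expand = solve-∀
  regroup : ∀ b c d e f → d * (e * b) + b * (c * f) ≡ b * d * e + f * (c * b)
  regroup = solve-∀
  distribute : ∀ a b d e f → b * d * e + f * (a * d + 1) ≡ a * d * f + b * d * e + f
  distribute = solve-∀
  bound : S + (b + d) ≤ S + f
  bound = begin
    S + (b + d)                       ≡⟨ expand a b d e f ⟩
    d * (a * f + 1) + b * (e * d + 1) ≤⟨ +-mono-≤ (*-monoʳ-≤ d (subst (_≤ e * b) (+-comm 1 (a * f)) af<eb))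
                                                  (*-monoʳ-≤ b (subst (_≤ c * f) (+-comm 1 (e * d)) ed<cf)) ⟩
    d * (e * b) + b * (c * f)         ≡⟨ regroup b c d e f ⟩
    b * d * e + f * (c * b)           ≡⟨ cong (λ t → b * d * e + f * t) adj ⟩
    b * d * e + f * (a * d + 1)       ≡⟨ distribute a b d e f ⟩
    S + f                             ∎

farey-lower-neighbour : ∀ {m z x y a b c d} L U → NumDen L a b → NumDen U c d → Adjacent a b c d →
  m ℕ.< b + d → InFarey m L → L < z → z < U → Consecutive m x y → x < z → z < y → x ≡ L
farey-lower-neighbour {m} {z} {x} {y} {a} {b} {c} {d} L U L≐ U≐ adj m<b+d L∈𝓕 L<z z<U (x∈𝓕 , _ , gap) x<z z<y =
  cross≡⇒≡ x≐ L≐ (sym (farey-gap a b c d ℤ.∣ ↥ x ∣ (↧ₙ x) adj m<b+d (proj₂ (proj₂ x∈𝓕))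
                                  (≤⇒cross≤ L≐ x≐ L≤x) (<⇒cross< x≐ U≐ x<U)))
  where
  x≐ = numDen-nonneg x (proj₁ x∈𝓕)
  L≤x : L ℚ.≤ x
  L≤x = ℚ.≮⇒≥ (λ x<L → gap L L∈𝓕 x<L (ℚ.<-trans L<z z<y))
  x<U : x < U
  x<U = ℚ.<-trans x<z z<U

Near : Block → Block → Set
Near C X = (length C ≤ length X + 1) × (length X ≤ length C + 1) × (take (length C ∸ 1) C ≡ take (length C ∸ 1) X)

∷ʳ-near : ∀ X a → Near (X ∷ʳ a) X
∷ʳ-near X a = ≤-reflexive (length-∷ʳ X a) , length≤length-∷ʳ+1 X a ,
  subst (λ n → take n (X ∷ʳ a) ≡ take n X) (sym length∸1) (take-++ˡ X _ ≤-refl)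
  where
  length∸1 : length (X ∷ʳ a) ∸ 1 ≡ length X
  length∸1 = trans (cong (_∸ 1) (length-∷ʳ X a)) (m+n∸n≡m _ 1)

near-∷ʳ : ∀ X a → Near X (X ∷ʳ a)
near-∷ʳ X a = length≤length-∷ʳ+1 X a , ≤-reflexive (length-∷ʳ X a) , sym (take-++ˡ X _ (m∸n≤m _ 1))

near-refl : ∀ X → Near X X
near-refl X = m≤m+n _ 1 , m≤m+n _ 1 , refl

near-chain : ∀ {A C X} → length A ≤ length C → Near A C → Near C X →
  (length A ≤ length X + 1) × (length X ≤ length A + 4) × (take (length A ∸ 1) A ≡ take (length A ∸ 1) X)
near-chain {A} {C} {X} A≤C (_ , C≤A+1 , A≈C) (C≤X+1 , X≤C+1 , C≈X) =
  ≤-trans A≤C C≤X+1 ,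
  ≤-trans X≤C+1 (≤-trans (+-monoˡ-≤ 1 C≤A+1) (n+1+1≤n+4 (length A))) ,
  trans A≈C (take-shorten C X (∸-monoˡ-≤ 1 A≤C) C≈X)
  where
  n+1+1≤n+4 : ∀ n → n + 1 + 1 ≤ n + 4
  n+1+1≤n+4 n = subst (_≤ n + 4) (sym (+-assoc n 1 1)) (+-monoʳ-≤ n (s≤s (s≤s z≤n)))

num≡0⇒≡[] : ∀ {X} → IsBlock X → num X ≡ 0 → X ≡ []
num≡0⇒≡[] [] _ = refl
num≡0⇒≡[] (_ ∷ bX) e with () ← subst (0 ℕ.<_) e (den-pos bX)

num≡den⇒length≡1 : ∀ {X} → IsBlock X → num X ≡ den X → length X ≡ 1
num≡den⇒length≡1 {suc a ∷ X} (_ ∷ bX) e = cong (λ Z → suc (length Z)) (num≡0⇒≡[] bX numX≡0)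
  where
  numX≡0 : num X ≡ 0
  numX≡0 = m+n≡0⇒n≡0 (a * den X) (+-cancelˡ-≡ (den X) _ 0
             (trans (sym (+-assoc (den X) (a * den X) (num X))) (trans (sym e) (sym (+-identityʳ (den X))))))

++-same-continuants : ∀ A {D} → IsBlock (A ++ D) → num (A ++ D) ≡ num A → den (A ++ D) ≡ den A → D ≡ []
++-same-continuants [] bD num≡ _ = num≡0⇒≡[] bD num≡
++-same-continuants (a ∷ A) (_ ∷ bAD) num≡ den≡ =
  ++-same-continuants A bAD
    (+-cancelˡ-≡ (a * den A) _ _ (trans (cong (λ t → a * t + num (A ++ _)) (sym num≡)) den≡)) num≡

take-same-continuants : ∀ {B i j} → IsBlock B → i ≤ j →
  num (take i B) ≡ num (take j B) → den (take i B) ≡ den (take j B) → take i B ≡ take j B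
take-same-continuants {B} {i} {j} bB i≤j num≡ den≡ = begin
  take i B                      ≡⟨ sym (++-identityʳ (take i B)) ⟩
  take i B ++ []                ≡⟨ cong (take i B ++_) (sym rest≡[]) ⟩
  take i B ++ drop i (take j B) ≡⟨ sym split ⟩
  take j B                      ∎
  where
  open ≡-Reasoning
  take-prefix : take i (take j B) ≡ take i B
  take-prefix = trans (take-take i j B) (cong (λ k → take k B) (m≤n⇒m⊓n≡m i≤j))
  split : take j B ≡ take i B ++ drop i (take j B)
  split = sym (trans (cong (_++ drop i (take j B)) (sym take-prefix)) (take++drop≡id i (take j B)))
  rest≡[] : drop i (take j B) ≡ []
  rest≡[] = ++-same-continuants (take i B) (subst IsBlock split (All.take⁺ j bB))
              (trans (sym (cong num split)) (sym num≡)) (trans (sym (cong den split)) (sym den≡))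

prefix-value-injective : ∀ {B i j} → IsBlock B → r (take i B) ≡ r (take j B) → take i B ≡ take j B
prefix-value-injective {B} {i} {j} bB r≡ with ≤-total i j
... | inj₁ i≤j = take-same-continuants bB i≤j (proj₁ same) (proj₂ same)
  where same = numDen-unique r≡ (r-numDen (All.take⁺ i bB)) (r-numDen (All.take⁺ j bB))
... | inj₂ j≤i = sym (take-same-continuants bB j≤i (proj₁ same) (proj₂ same))
  where same = numDen-unique (sym r≡) (r-numDen (All.take⁺ j bB)) (r-numDen (All.take⁺ i bB))

digit-mismatch : ∀ {a c d n n′} → a ℕ.< c → n ≤ d → a * d + n ≡ c * d + n′ → n′ ≡ 0 × n ≡ d
digit-mismatch {a} {c} {d} {n} {n′} a<c n≤d e =
  n≤0⇒n≡0 (+-cancelˡ-≤ d _ _ (subst (d + n′ ≤_) (sym (+-identityʳ d)) (≤-trans d+n′≤n n≤d))) ,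
  ≤-antisym n≤d (≤-trans (m≤m+n d n′) d+n′≤n)
  where
  open ≤-Reasoning
  d+n′≤n : d + n′ ≤ n
  d+n′≤n = +-cancelˡ-≤ (a * d) _ _ (begin
    a * d + (d + n′) ≡⟨ sym (+-assoc (a * d) d n′) ⟩
    a * d + d + n′   ≡⟨ cong (_+ n′) (+-comm (a * d) d) ⟩
    suc a * d + n′   ≤⟨ +-monoˡ-≤ n′ (*-monoˡ-≤ d a<c) ⟩
    c * d + n′       ≡⟨ sym e ⟩
    a * d + n        ∎)

same-continuants-near : ∀ {A C} → IsBlock A → IsBlock C → num A ≡ num C → den A ≡ den C →
                        length A ≤ length C → Near A C
same-continuants-near [] bC num≡ _ _ rewrite num≡0⇒≡[] bC (sym num≡) = z≤n , z≤n , refl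
same-continuants-near {a ∷ A} {c ∷ C} (_ ∷ bA) (_ ∷ bC) num≡ den≡ (s≤s A≤C) with <-cmp a c
... | tri≈ _ refl _ with same-continuants-near bA bC
       (+-cancelˡ-≡ (a * den A) _ _ (trans den≡ (cong (λ t → a * t + num C) (sym num≡)))) num≡ A≤C
...   | A≤C+1 , C≤A+1 , prefix = s≤s A≤C+1 , s≤s C≤A+1 , take-∷-cong (length A) a A C prefix
same-continuants-near {a ∷ A} {c ∷ C} (_ ∷ bA) (_ ∷ bC) num≡ den≡ (s≤s A≤C) | tri< a<c _ _
  with digit-mismatch a<c (num≤den bA) (trans den≡ (cong (λ t → c * t + num C) (sym num≡)))
... | numC≡0 , numA≡denA with refl ← num≡0⇒≡[] bC numC≡0
  with () ← subst (_≤ 0) (num≡den⇒length≡1 bA numA≡denA) A≤C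
same-continuants-near {a ∷ A} {c ∷ C} (_ ∷ bA) (_ ∷ bC) num≡ den≡ (s≤s A≤C) | tri> _ _ c<a
  with digit-mismatch c<a (subst (num C ≤_) (sym num≡) (num≤den bC))
                        (sym (trans den≡ (cong (λ t → c * t + num C) (sym num≡))))
... | numA≡0 , numC≡denA with refl ← num≡0⇒≡[] bA numA≡0 =
  s≤s z≤n , subst (λ l → suc l ≤ 2) (sym (num≡den⇒length≡1 bC (trans numC≡denA num≡))) ≤-refl , refl

same-value-near : ∀ {A C} → IsBlock A → IsBlock C → r A ≡ r C → length A ≤ length C → Near A C
same-value-near bA bC r≡ = same-continuants-near bA bC (proj₁ same) (proj₂ same)
  where same = numDen-unique r≡ (r-numDen bA) (r-numDen bC)

truncateAt : ℕ → Block → Block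
truncateAt m B = take (search m B (length B)) B

search≤ : ∀ m B n → search m B n ≤ n
search≤ m B zero = z≤n
search≤ m B (suc n) with q (take (suc n) B) ≤ᵇ m
... | true = ≤-refl
... | false = m≤n⇒m≤1+n (search≤ m B n)

q-search≤ : ∀ {m} B n → 1 ≤ m → q (take (search m B n) B) ≤ m
q-search≤ B zero 1≤m = 1≤m
q-search≤ {m} B (suc n) 1≤m with q (take (suc n) B) ≤ᵇ m in eq
... | true = ≤ᵇ⇒≤ _ _ (subst T (sym eq) tt)
... | false = q-search≤ B n 1≤m

search-maximal : ∀ m B n → search m B n ≡ n ⊎ m ℕ.< q (take (suc (search m B n)) B)
search-maximal m B zero = inj₁ refl
search-maximal m B (suc n) with q (take (suc n) B) ≤ᵇ m in eq
... | true = inj₁ refl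
... | false with search-maximal m B n
...   | inj₂ h = inj₂ h
...   | inj₁ e rewrite e = inj₂ (≰⇒> (λ le → subst T eq (≤⇒≤ᵇ le)))

truncation-short : ∀ {m} B → 1 ≤ m → ¬ q B ≤ m → search m B (length B) ℕ.< length B
truncation-short {m} B 1≤m qB>m with m≤n⇒m<n∨m≡n (search≤ m B (length B))
... | inj₁ k<n = k<n
... | inj₂ k≡n = ⊥-elim (qB>m (subst (λ t → q t ≤ m) B′≡B (q-search≤ B (length B) 1≤m)))
  where
  B′≡B : truncateAt m B ≡ B
  B′≡B = trans (cong (λ t → take t B) k≡n) (take-all (length B) B ≤-refl)

split-at-truncation : ∀ {m} B → 1 ≤ m → ¬ q B ≤ m →
  ∃₂ λ a Y → B ≡ truncateAt m B ++ a ∷ Y × q (truncateAt m B) ≤ m × m ℕ.< q (truncateAt m B ∷ʳ a)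
split-at-truncation {m} B 1≤m qB>m
  with split-at (search m B (length B)) B (truncation-short B 1≤m qB>m) | search-maximal m B (length B)
... | a , Y , B≡ , take≡ | inj₂ m<q = a , Y , B≡ , q-search≤ B (length B) 1≤m , subst (λ t → m ℕ.< q t) take≡ m<q
... | _ | inj₁ k≡n = ⊥-elim (<-irrefl k≡n (truncation-short B 1≤m qB>m))

intermediate-block : ∀ {X} j → IsBlock X → (j ≡ 0 → X ≡ [] → ⊥) →
  ∃[ V ] IsBlock V × NumDen (r V) (numAt X j 1) (denAt X j 1) × Near V X
intermediate-block {X} (suc i) bX _ =
  X ∷ʳ suc i , bV , subst₂ (NumDen (r (X ∷ʳ suc i))) (num-∷ʳ X (suc i)) (den-∷ʳ X (suc i)) (r-numDen bV) ,
  ∷ʳ-near X (suc i)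
  where
  bV = All.++⁺ bX (s≤s z≤n ∷ [])
intermediate-block {X} zero bX X≢[] with initLast X
... | [] = ⊥-elim (X≢[] refl refl)
... | X′ ∷ʳ′ b =
  X′ , bX′ , subst₂ (NumDen (r X′)) (at-∞ (num X) (num∞-∷ʳ X′ b)) (at-∞ (den X) (den∞-∷ʳ X′ b)) (r-numDen bX′) ,
  near-∷ʳ X′ b
  where
  bX′ = All.++⁻ˡ X′ bX
  at-∞ : ∀ n {n∞ t} → n∞ ≡ t → t ≡ n * 0 + n∞ * 1
  at-∞ n {n∞} refl = sym (cong₂ _+_ (*-zeroʳ n) (*-identityʳ n∞))

largest-intermediate : ∀ {m X} → IsBlock X → den X ≤ m →
  ∃[ j ] denAt X j 1 ≤ m × m ℕ.< denAt X 1 0 + denAt X j 1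
largest-intermediate {m} {X} bX den≤m = j , lower , upper
  where
  instance _ = ℕ.>-nonZero (den-pos bX)
  d = den X
  e = den∞ X
  e≤m = ≤-trans (den∞≤den bX) den≤m
  t = m ∸ e
  j = t / d
  lower-form : ∀ d e j → d * j + e * 1 ≡ e + j * d
  lower-form = solve-∀
  upper-form : ∀ d e j → e + (d + j * d) ≡ (d * 1 + e * 0) + (d * j + e * 1)
  upper-form = solve-∀
  lower : d * j + e * 1 ≤ m
  lower = begin
    d * j + e * 1 ≡⟨ lower-form d e j ⟩
    e + j * d     ≤⟨ +-monoʳ-≤ e (m/n*n≤m t d) ⟩
    e + t         ≡⟨ m+[n∸m]≡n e≤m ⟩
    m             ∎
    where open ≤-Reasoning
  upper : m ℕ.< (d * 1 + e * 0) + (d * j + e * 1)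
  upper = begin-strict
    m                   ≡⟨ sym (m+[n∸m]≡n e≤m) ⟩
    e + t               ≡⟨ cong (e +_) (m≡m%n+[m/n]*n t d) ⟩
    e + (t % d + j * d) <⟨ +-monoʳ-< e (+-monoˡ-< (j * d) (m%n<n t d)) ⟩
    e + (d + j * d)     ≡⟨ upper-form d e j ⟩
    (d * 1 + e * 0) + (d * j + e * 1) ∎
    where open ≤-Reasoning

tail-below : ∀ {a j Y} → IsBlock Y → j ℕ.< a → num (a ∷ Y) * j ℕ.< 1 * den (a ∷ Y)
tail-below {a} {j} {Y} bY j<a = begin-strict
  den Y * j            <⟨ *-monoʳ-< (den Y) j<a ⟩
  den Y * a            ≡⟨ *-comm (den Y) a ⟩
  a * den Y            ≤⟨ m≤m+n (a * den Y) (num Y) ⟩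
  a * den Y + num Y    ≡⟨ sym (*-identityˡ _) ⟩
  1 * (a * den Y + num Y) ∎
  where
  open ≤-Reasoning
  instance _ = ℕ.>-nonZero (den-pos bY)

farey-neighbour-block : ∀ {m X a Y x y} → 1 ≤ m → IsBlock (X ++ a ∷ Y) → q X ≤ m → m ℕ.< q (X ∷ʳ a) →
  Consecutive m x y → x < r (X ++ a ∷ Y) → r (X ++ a ∷ Y) < y → ∃[ C ] IsBlock C × r C ≡ x × Near C X
farey-neighbour-block {m} {X} {a} {Y} {x} {y} 1≤m bB qX≤m m<qXa cons x<z z<y
  with All.++⁻ X bB
... | bX , a>0 ∷ bY
  with largest-intermediate bX (subst (_≤ m) (q≡den bX) qX≤m)
... | j , lower , upper
  with intermediate-block j bX (λ { refl refl → <⇒≱ upper 1≤m })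
... | V , bV , V≐ , V≈X = lower-neighbour (unimodular X)
  where
  α = den (a ∷ Y)
  β = num (a ∷ Y)
  X≐ = value-at-0 bX
  z≐ : NumDen (r (X ++ a ∷ Y)) (numAt X α β) (denAt X α β)
  z≐ = subst₂ (NumDen (r (X ++ a ∷ Y))) (num-++ X (a ∷ Y)) (den-++ X (a ∷ Y)) (r-numDen bB)
  z>0 : 0 * α ℕ.< β * 1
  z>0 = subst (0 ℕ.<_) (sym (*-identityʳ β)) (den-pos bY)
  m<den : m ℕ.< denAt X a 1
  m<den = subst (m ℕ.<_) (trans (q≡den (All.++⁺ bX (a>0 ∷ []))) (den-∷ʳ X a)) m<qXa
  z<1/j : β * j ℕ.< 1 * α
  z<1/j = tail-below bY (*-cancelˡ-< (den X) j a (+-cancelʳ-< (den∞ X * 1) _ _ (≤-<-trans lower m<den)))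
  lower-neighbour : Unimodular X → ∃[ C ] IsBlock C × r C ≡ x × Near C X
  lower-neighbour (inj₁ h) =
    X , bX , sym (farey-lower-neighbour (r X) (r V) X≐ V≐ (at-tail-adjacent⁺ X 1 0 j 1 h refl) upper
                    (r-InFarey bX qX≤m)
                    (at-tail-increasing X 1 0 α β X≐ z≐ h z>0) (at-tail-increasing X α β j 1 z≐ V≐ h z<1/j)
                    cons x<z z<y) ,
    near-refl X
  lower-neighbour (inj₂ h) =
    V , bV , sym (farey-lower-neighbour (r V) (r X) V≐ X≐ (at-tail-adjacent⁻ X 1 0 j 1 h refl)
                    (subst (m ℕ.<_) (+-comm (denAt X 1 0) (denAt X j 1)) upper)
                    (r-InFarey bV (subst (_≤ m) (sym (proj₂ V≐)) lower))
                    (at-tail-decreasing X α β j 1 z≐ V≐ h z<1/j) (at-tail-decreasing X 1 0 α β X≐ z≐ h z>0)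
                    cons x<z z<y) ,
    V≈X

lemma3p10 : (m : ℕ) → 2 ≤ m → (B : Block) → IsBlock B → m ≤ q B →
    (x y : ℚ) → x < y → Consecutive m x y → x < r B → r B < y →
    (B₁ : Block) → IsBlock B₁ → r B₁ ≡ x →
    (∀ (C : Block) → IsBlock C → r C ≡ x → length B₁ ≤ length C) →
    (B₂ : Block) → (∃[ k ] B₂ ≡ take k B) → r B₂ ≡ rAt m B →
    (length B₁ ≤ length B₂ + 1) × (length B₂ ≤ length B₁ + 4) ×
    (take (length B₁ ∸ 1) B₁ ≡ take (length B₁ ∸ 1) B₂)
lemma3p10 m 2≤m B bB _ x y _ cons x<rB rB<y B₁ bB₁ rB₁≡x shortest B₂ (k , B₂≡) rB₂≡
  with refl ← trans B₂≡ (prefix-value-injective {i = k} {j = search m B (length B)} bB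
                          (trans (cong r (sym B₂≡)) rB₂≡)) =
  let 1≤m = ≤-trans (n≤1+n 1) 2≤m
      a , Y , B≡ , qX≤m , m<qXa =
        split-at-truncation B 1≤m (λ qB≤m → proj₂ (proj₂ cons) (r B) (r-InFarey bB qB≤m) x<rB rB<y)
      C , bC , rC≡x , C≈X =
        farey-neighbour-block 1≤m (subst IsBlock B≡ bB) qX≤m m<qXa cons
          (subst (λ t → x < r t) B≡ x<rB) (subst (λ t → r t < y) B≡ rB<y)
      B₁≤C = shortest C bC rC≡x
  in near-chain B₁≤C (same-value-near bB₁ bC (trans rB₁≡x (sym rC≡x)) B₁≤C) C≈X
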